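{- For every odd $n \ge 3$, the group $C_n \times D_{2n}$ is non-CCA; that is, there exists a connected Cayley graph of $C_n\times D_{2n}$ that admits a colour-preserving automorphism which is not affine.
   Context: For a group $G$ and $C \subseteq G\setminus\{e\}$, the Cayley graph $\mathrm{Cay}(G,C)$ has vertex set $G$ and an edge between $g$ and $gc$ for each $g\in G$, $c \in C$; the edge $\{g,gc\}$ is coloured $\{c,c^{ -1}\}$. A colour-preserving automorphism is a graph automorphism mapping each edge to an edge of the same colour. A permutation of $G$ is affine if it has the form $g\mapsto h\alpha(g)$ with $h\in G$ and $\alpha\in\mathrm{Aut}(G)$. A Cayley graph is CCA if all its colour-preserving automorphisms are affine; a group $G$ is CCA if every connected Cayley graph of $G$ is CCA, and non-CCA otherwise. $C_n$ is the cyclic group of order $n$, $D_{2n}$ the dihedral group of order $2n$. -}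

module Defs where

open import Data.Nat using (ℕ; zero; suc; _+_; _∸_; NonZero)
open import Data.Nat.DivMod using (_%_; m%n<n)
open import Data.Fin using (Fin; toℕ; fromℕ<)
open import Data.Bool using (Bool; true; false; _xor_)
open import Data.Product using (Σ; ∃; ∃-syntax; _×_; _,_)
open import Data.Sum using (_⊎_)
open import Relation.Nullary using (¬_)
open import Relation.Binary.PropositionalEquality using (_≡_; _≢_)
open import Function.Definitions using (Bijective)
open import Function.Bundles using (_⇔_)

record GroupOps : Set₁ where
  field
    Carrier : Set
    _·_     : Carrier → Carrier → Carrier
    e       : Carrier
    inv     : Carrier → Carrier
  infixl 7 _·_

module Cayley (G : GroupOps) where
  open GroupOps G

  Adj : (Carrier → Set) → Carrier → Carrier → Set
  Adj C g h = ∃[ c ] (C c × (h ≡ g · c ⊎ g ≡ h · c))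

  data Path (C : Carrier → Set) (g : Carrier) : Carrier → Set where
    here : Path C g g
    step : ∀ {h k} → Path C g h → Adj C h k → Path C g k

  Connected : (Carrier → Set) → Set
  Connected C = ∀ g h → Path C g h

  ColourPreservingAut : (Carrier → Set) → (Carrier → Carrier) → Set
  ColourPreservingAut C f =
    Bijective _≡_ _≡_ f
    × (∀ g h → Adj C g h ⇔ Adj C (f g) (f h))
    × (∀ g c → C c → (f (g · c) ≡ f g · c ⊎ f (g · c) ≡ f g · inv c))

  IsGroupAut : (Carrier → Carrier) → Set
  IsGroupAut α = Bijective _≡_ _≡_ α × (∀ x y → α (x · y) ≡ α x · α y)

  Affine : (Carrier → Carrier) → Set
  Affine f = ∃[ h ] ∃[ α ] (IsGroupAut α × (∀ g → f g ≡ h · α g))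

  NonCCA : Set₁
  NonCCA = Σ (Carrier → Set) λ C →
    (∀ c → C c → c ≢ e) × Connected C
    × ∃[ f ] (ColourPreservingAut C f × ¬ Affine f)

module _ {n : ℕ} .{{_ : NonZero n}} where
  _⊕_ : Fin n → Fin n → Fin n
  a ⊕ b = fromℕ< (m%n<n (toℕ a + toℕ b) n)

  ⊖_ : Fin n → Fin n
  ⊖ a = fromℕ< (m%n<n (n ∸ toℕ a) n)

  𝟘 : Fin n
  𝟘 = fromℕ< (m%n<n 0 n)

-- An element (a , i , b) stands for (x^a , r^i s^b) where
-- C_n = ⟨x⟩ and D_2n = ⟨r, s | r^n = s^2 = 1, s r s = r⁻¹⟩ (b = true means
-- the factor s is present).  Then
--   r^i s^b · r^j s^c = r^(i + (-1)^b j) s^(b xor c).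

CnD2n : (n : ℕ) .{{_ : NonZero n}} → GroupOps
CnD2n n = record
  { Carrier = Fin n × Fin n × Bool
  ; _·_ = mul
  ; e = (𝟘 , 𝟘 , false)
  ; inv = inv
  }
  where
  mul : Fin n × Fin n × Bool → Fin n × Fin n × Bool → Fin n × Fin n × Bool
  mul (a , i , false) (a' , j , c) = (a ⊕ a' , i ⊕ j , c)
  mul (a , i , true)  (a' , j , c) = (a ⊕ a' , i ⊕ (⊖ j) , true xor c)
  inv : Fin n × Fin n × Bool → Fin n × Fin n × Bool
  inv (a , i , false) = (⊖ a , ⊖ i , false)
  inv (a , i , true)  = (⊖ a , i , true)

-- With elements written (a , i , b) ↔ x^a r^i s^b, take the generators s, t = x r
-- and t⁻¹.  Right multiplication by t adds (1 , 1) to (a , i) on the rotation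
-- coset and (1 , -1) on the reflection coset, so the swap (a , i , b) ↦ (i , a , b)
-- carries every t-edge to a t- or t⁻¹-edge, and it commutes with the reflection s;
-- hence it is a colour-preserving automorphism.  It is not affine: an affine map
-- followed by the projection onto C_n, a homomorphism to an abelian group, takes
-- the same value on s r and r s, whereas the swap gives x⁻¹ and x.  The graph is
-- connected because t s t⁻¹ s = r², which generates all rotations when n is odd.
module Submission where

open import Defs
open import Algebra.Bundles using (AbelianGroup)
open import Algebra.Structures using (IsAbelianGroup)
open import Algebra.Consequences.Propositional using (comm∧idʳ⇒id; comm∧invʳ⇒inv)
import Algebra.Properties.AbelianGroup as AbelianGroupProperties
open import Data.Bool using (true; false; not)
open import Data.Fin using (Fin; toℕ; fromℕ<)
open import Data.Fin.Properties using (toℕ-fromℕ<; toℕ-injective; toℕ<n)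
open import Data.Nat using (ℕ; zero; suc; _+_; _*_; _∸_; _<_; _≤_; NonZero; >-nonZero⁻¹)
open import Data.Nat.Divisibility using (_∣_; divides)
open import Data.Nat.DivMod using (_%_; m%n<n; %-distribˡ-+; m<n⇒m%n≡m; n%n≡0; [m+kn]%n≡m%n)
open import Data.Nat.Properties using (1+n≢0; +-comm; +-identityʳ; +-assoc; *-identityʳ; *-zeroʳ; m+[n∸m]≡n; <⇒≤; <-trans; n<1+n)
open import Data.Nat.Tactic.RingSolver using (solve-∀)
open import Data.Empty using (⊥-elim)
open import Data.Product using (∃-syntax; _×_; _,_; proj₁)
open import Data.Sum using (_⊎_; inj₁; inj₂)
open import Function.Bundles using (_⇔_; mk⇔)
open import Function.Definitions using (Bijective)
open import Function.Consequences using (inverseᵇ⇒bijective)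
open import Function.Consequences.Propositional using (strictlyInverseˡ⇒inverseˡ; strictlyInverseʳ⇒inverseʳ)
open import Function.Base using (_∘_)
open import Relation.Nullary using (¬_)
open import Relation.Binary.PropositionalEquality

module CayleyProperties (G : GroupOps) where
  open GroupOps G
  open Cayley G

  module _ {C : Carrier → Set} where

    infixr 5 _++_

    _++_ : ∀ {g h k} → Path C g h → Path C h k → Path C g k
    p ++ here       = p
    p ++ step q adj = step (p ++ q) adj

    path-edge : ∀ {g c} → C c → Path C g (g · c)
    path-edge {c = c} Cc = step here (c , Cc , inj₁ refl)

  RespectsColours : (Carrier → Set) → (Carrier → Carrier) → Set
  RespectsColours C f = ∀ g c → C c → f (g · c) ≡ f g · c ⊎ f (g · c) ≡ f g · inv c

  module _ {C : Carrier → Set} {f : Carrier → Carrier}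
           (inv-closed : ∀ c → C c → C (inv c))
           (resp : RespectsColours C f) where

    edge-image : ∀ g c → C c → ∃[ c′ ] (C c′ × f (g · c) ≡ f g · c′)
    edge-image g c Cc with resp g c Cc
    ... | inj₁ eq = c , Cc , eq
    ... | inj₂ eq = inv c , inv-closed c Cc , eq

    adjacency-preserved : ∀ g h → Adj C g h → Adj C (f g) (f h)
    adjacency-preserved g h (c , Cc , inj₁ h≡gc) =
      let c′ , Cc′ , eq = edge-image g c Cc in c′ , Cc′ , inj₁ (trans (cong f h≡gc) eq)
    adjacency-preserved g h (c , Cc , inj₂ g≡hc) =
      let c′ , Cc′ , eq = edge-image h c Cc in c′ , Cc′ , inj₂ (trans (cong f g≡hc) eq)

    involution⇒colourPreservingAut : (∀ g → f (f g) ≡ g) → ColourPreservingAut C f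
    involution⇒colourPreservingAut invol = bijective , adjacency , resp
      where
      bijective : Bijective _≡_ _≡_ f
      bijective = inverseᵇ⇒bijective _≡_ refl sym trans
        (strictlyInverseˡ⇒inverseˡ f invol , strictlyInverseʳ⇒inverseʳ f invol)
      adjacency : ∀ g h → Adj C g h ⇔ Adj C (f g) (f h)
      adjacency g h = mk⇔ (adjacency-preserved g h)
        (λ adj → subst₂ (Adj C) (invol g) (invol h) (adjacency-preserved (f g) (f h) adj))

  affine-image-comm : {A : Set} {_∙_ : A → A → A} → (∀ a b → a ∙ b ≡ b ∙ a) →
                      (π : Carrier → A) → (∀ x y → π (x · y) ≡ π x ∙ π y) →
                      ∀ {f} → Affine f → ∀ x y → π (f (x · y)) ≡ π (f (y · x))
  affine-image-comm {_∙_ = _∙_} comm π π-hom {f} (h , α , (_ , α-hom) , f≡hα) x y = begin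
    π (f (x · y))           ≡⟨ cong π (f≡hα (x · y)) ⟩
    π (h · α (x · y))       ≡⟨ cong (λ z → π (h · z)) (α-hom x y) ⟩
    π (h · (α x · α y))     ≡⟨ π-hom h _ ⟩
    π h ∙ π (α x · α y)     ≡⟨ cong (π h ∙_) (π-comm (α x) (α y)) ⟩
    π h ∙ π (α y · α x)     ≡⟨ π-hom h _ ⟨
    π (h · (α y · α x))     ≡⟨ cong (λ z → π (h · z)) (α-hom y x) ⟨
    π (h · α (y · x))       ≡⟨ cong π (f≡hα (y · x)) ⟨
    π (f (y · x))           ∎
    where
    open ≡-Reasoning
    π-comm : ∀ u v → π (u · v) ≡ π (v · u)
    π-comm u v = trans (π-hom u v) (trans (comm (π u) (π v)) (sym (π-hom v u)))

¬2∣⇒odd : ∀ {n} → ¬ 2 ∣ n → ∃[ h ] n ≡ suc (h * 2)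
¬2∣⇒odd {zero} ¬2∣n = ⊥-elim (¬2∣n (divides 0 refl))
¬2∣⇒odd {suc zero} _ = 0 , refl
¬2∣⇒odd {suc (suc n)} ¬2∣n+2 =
  let h , n≡1+2h = ¬2∣⇒odd (λ { (divides q n≡q2) → ¬2∣n+2 (divides (suc q) (cong (2 +_) n≡q2)) })
  in suc h , cong (2 +_) n≡1+2h

module ZMod (n : ℕ) .{{_ : NonZero n}} where

  residue : ℕ → Fin n
  residue k = fromℕ< (m%n<n k n)

  toℕ-residue : ∀ k → toℕ (residue k) ≡ k % n
  toℕ-residue k = toℕ-fromℕ< (m%n<n k n)

  residue-cong : ∀ {k m} → k % n ≡ m % n → residue k ≡ residue m
  residue-cong {k} {m} eq = toℕ-injective (trans (toℕ-residue k) (trans eq (sym (toℕ-residue m))))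

  residue-injective : ∀ {k m} → k < n → m < n → residue k ≡ residue m → k ≡ m
  residue-injective {k} {m} k<n m<n eq = begin
    k                  ≡⟨ m<n⇒m%n≡m k<n ⟨
    k % n              ≡⟨ toℕ-residue k ⟨
    toℕ (residue k)    ≡⟨ cong toℕ eq ⟩
    toℕ (residue m)    ≡⟨ toℕ-residue m ⟩
    m % n              ≡⟨ m<n⇒m%n≡m m<n ⟩
    m                  ∎
    where open ≡-Reasoning

  residue-toℕ : ∀ a → residue (toℕ a) ≡ a
  residue-toℕ a = toℕ-injective (trans (toℕ-residue (toℕ a)) (m<n⇒m%n≡m (toℕ<n a)))

  residue-+ : ∀ k m → residue (k + m) ≡ residue k ⊕ residue m
  residue-+ k m = residue-cong (trans (%-distribˡ-+ k m n)
    (sym (cong₂ (λ u v → (u + v) % n) (toℕ-residue k) (toℕ-residue m))))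

  ⊕-comm : ∀ a b → a ⊕ b ≡ b ⊕ a
  ⊕-comm a b = cong residue (+-comm (toℕ a) (toℕ b))

  ⊕-assoc : ∀ a b c → (a ⊕ b) ⊕ c ≡ a ⊕ (b ⊕ c)
  ⊕-assoc a b c = begin
    (a ⊕ b) ⊕ c                           ≡⟨ cong ((a ⊕ b) ⊕_) (residue-toℕ c) ⟨
    residue (ta + tb) ⊕ residue tc         ≡⟨ residue-+ (ta + tb) tc ⟨
    residue (ta + tb + tc)                 ≡⟨ cong residue (+-assoc ta tb tc) ⟩
    residue (ta + (tb + tc))               ≡⟨ residue-+ ta (tb + tc) ⟩
    residue ta ⊕ residue (tb + tc)         ≡⟨ cong (_⊕ (b ⊕ c)) (residue-toℕ a) ⟩
    a ⊕ (b ⊕ c)                           ∎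
    where
    open ≡-Reasoning
    ta tb tc : ℕ
    ta = toℕ a
    tb = toℕ b
    tc = toℕ c

  ⊕-identityʳ : ∀ a → a ⊕ 𝟘 ≡ a
  ⊕-identityʳ a = begin
    a ⊕ 𝟘                         ≡⟨ cong (_⊕ 𝟘) (residue-toℕ a) ⟨
    residue (toℕ a) ⊕ residue 0   ≡⟨ residue-+ (toℕ a) 0 ⟨
    residue (toℕ a + 0)           ≡⟨ cong residue (+-identityʳ (toℕ a)) ⟩
    residue (toℕ a)               ≡⟨ residue-toℕ a ⟩
    a                             ∎
    where open ≡-Reasoning

  ⊕-inverseʳ : ∀ a → a ⊕ (⊖ a) ≡ 𝟘
  ⊕-inverseʳ a = begin
    a ⊕ (⊖ a)                             ≡⟨ cong (_⊕ (⊖ a)) (residue-toℕ a) ⟨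
    residue (toℕ a) ⊕ residue (n ∸ toℕ a) ≡⟨ residue-+ (toℕ a) (n ∸ toℕ a) ⟨
    residue (toℕ a + (n ∸ toℕ a))         ≡⟨ cong residue (m+[n∸m]≡n (<⇒≤ (toℕ<n a))) ⟩
    residue n                             ≡⟨ residue-cong (trans (n%n≡0 n) (sym (m<n⇒m%n≡m (>-nonZero⁻¹ n)))) ⟩
    𝟘                                     ∎
    where open ≡-Reasoning

  ⊕-⊖-isAbelianGroup : IsAbelianGroup _≡_ _⊕_ 𝟘 ⊖_
  ⊕-⊖-isAbelianGroup = record
    { isGroup = record
      { isMonoid = record
        { isSemigroup = record
          { isMagma = record { isEquivalence = isEquivalence ; ∙-cong = cong₂ _⊕_ }
          ; assoc = ⊕-assoc
          }
        ; identity = comm∧idʳ⇒id ⊕-comm ⊕-identityʳ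
        }
      ; inverse = comm∧invʳ⇒inv ⊕-comm ⊕-inverseʳ
      ; ⁻¹-cong = cong ⊖_
      }
    ; comm = ⊕-comm
    }

  ⊕-⊖-abelianGroup : AbelianGroup _ _
  ⊕-⊖-abelianGroup = record { isAbelianGroup = ⊕-⊖-isAbelianGroup }

  open AbelianGroupProperties ⊕-⊖-abelianGroup public
    using (ε⁻¹≈ε; ⁻¹-involutive; ⁻¹-injective; \\-leftDividesˡ)
  open AbelianGroup ⊕-⊖-abelianGroup public
    using (identityˡ)

  ⊕-residue-+ : ∀ a k m → a ⊕ residue (k + m) ≡ (a ⊕ residue k) ⊕ residue m
  ⊕-residue-+ a k m = trans (cong (a ⊕_) (residue-+ k m)) (sym (⊕-assoc a (residue k) (residue m)))

  residue-translate : ∀ a b → ∃[ k ] a ⊕ residue k ≡ b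
  residue-translate a b = toℕ ((⊖ a) ⊕ b) , trans (cong (a ⊕_) (residue-toℕ _)) (\\-leftDividesˡ a b)

  residue-double-translate : ¬ 2 ∣ n → ∀ a b → ∃[ k ] a ⊕ residue (k * 2) ≡ b
  residue-double-translate n-odd a b =
    let h , n≡1+2h = ¬2∣⇒odd n-odd
        j , a⊕j≡b = residue-translate a b
    in j * suc h , trans (cong (a ⊕_) (residue-cong (doubled-half j h n≡1+2h))) a⊕j≡b
    where
    -- suc h is the inverse of 2 modulo n = 1 + 2 h
    doubled-half : ∀ j h → n ≡ suc (h * 2) → (j * suc h * 2) % n ≡ j % n
    doubled-half j h n≡1+2h = begin
      (j * suc h * 2) % n        ≡⟨ cong (_% n) (double-suc j h) ⟩
      (j + j * suc (h * 2)) % n  ≡⟨ cong (λ m → (j + j * m) % n) n≡1+2h ⟨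
      (j + j * n) % n            ≡⟨ [m+kn]%n≡m%n j j n ⟩
      j % n                      ∎
      where
      open ≡-Reasoning
      double-suc : ∀ j h → j * suc h * 2 ≡ j + j * suc (h * 2)
      double-suc = solve-∀

module SwapAutomorphism (n : ℕ) .{{_ : NonZero n}} where
  open ZMod n
  open GroupOps (CnD2n n)
  open Cayley (CnD2n n)
  open CayleyProperties (CnD2n n)

  𝟙 : Fin n
  𝟙 = residue 1

  diagonal : Fin n → Carrier
  diagonal d = (d , d , false)

  s t : Carrier
  s = (𝟘 , 𝟘 , true)
  t = diagonal 𝟙

  Gens : Carrier → Set
  Gens c = c ≡ s ⊎ c ≡ t ⊎ c ≡ inv t

  swap : Carrier → Carrier
  swap (a , i , b) = (i , a , b)

  ·s : ∀ a i b → (a , i , b) · s ≡ (a , i , not b)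
  ·s a i false = cong₂ (λ u v → (u , v , true)) (⊕-identityʳ a) (⊕-identityʳ i)
  ·s a i true  = cong₂ (λ u v → (u , v , false)) (⊕-identityʳ a) (trans (cong (i ⊕_) ε⁻¹≈ε) (⊕-identityʳ i))

  Gens-inverseClosed : ∀ c → Gens c → Gens (inv c)
  Gens-inverseClosed _ (inj₁ refl)        = inj₁ (cong (λ u → (u , 𝟘 , true)) ε⁻¹≈ε)
  Gens-inverseClosed _ (inj₂ (inj₁ refl)) = inj₂ (inj₂ refl)
  Gens-inverseClosed _ (inj₂ (inj₂ refl)) = inj₂ (inj₁ (cong diagonal (⁻¹-involutive 𝟙)))

  swap-diagonal : ∀ g d → swap (g · diagonal d) ≡ swap g · diagonal d ⊎ swap (g · diagonal d) ≡ swap g · inv (diagonal d)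
  swap-diagonal (a , i , false) d = inj₁ refl
  swap-diagonal (a , i , true)  d = inj₂ (cong (λ v → (i ⊕ (⊖ d) , a ⊕ v , true)) (sym (⁻¹-involutive d)))

  swap-respectsColours : RespectsColours Gens swap
  swap-respectsColours (a , i , b) _ (inj₁ refl)        = inj₁ (trans (cong swap (·s a i b)) (sym (·s i a b)))
  swap-respectsColours g           _ (inj₂ (inj₁ refl)) = swap-diagonal g 𝟙
  swap-respectsColours g           _ (inj₂ (inj₂ refl)) = swap-diagonal g (⊖ 𝟙)

  swap-colourPreservingAut : ColourPreservingAut Gens swap
  swap-colourPreservingAut =
    involution⇒colourPreservingAut Gens-inverseClosed swap-respectsColours (λ _ → refl)

  𝟙≢𝟘 : 1 < n → 𝟙 ≢ 𝟘
  𝟙≢𝟘 1<n = 1+n≢0 ∘ residue-injective 1<n (>-nonZero⁻¹ n)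

  ⊖𝟙≢𝟙 : 2 < n → ⊖ 𝟙 ≢ 𝟙
  ⊖𝟙≢𝟙 2<n ⊖𝟙≡𝟙 = 1+n≢0 (residue-injective 2<n (>-nonZero⁻¹ n) (begin
    residue 2      ≡⟨ residue-+ 1 1 ⟩
    𝟙 ⊕ 𝟙          ≡⟨ cong (𝟙 ⊕_) ⊖𝟙≡𝟙 ⟨
    𝟙 ⊕ (⊖ 𝟙)      ≡⟨ ⊕-inverseʳ 𝟙 ⟩
    𝟘              ∎))
    where open ≡-Reasoning

  Gens-nonidentity : 1 < n → ∀ c → Gens c → c ≢ e
  Gens-nonidentity _   _ (inj₁ refl) ()
  Gens-nonidentity 1<n _ (inj₂ (inj₁ refl)) t≡e = 𝟙≢𝟘 1<n (cong proj₁ t≡e)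
  Gens-nonidentity 1<n _ (inj₂ (inj₂ refl)) t⁻¹≡e =
    𝟙≢𝟘 1<n (⁻¹-injective (trans (cong proj₁ t⁻¹≡e) (sym ε⁻¹≈ε)))

  proj₁-· : ∀ g h → proj₁ (g · h) ≡ proj₁ g ⊕ proj₁ h
  proj₁-· (_ , _ , false) _ = refl
  proj₁-· (_ , _ , true)  _ = refl

  swap-not-affine : 2 < n → ¬ Affine swap
  swap-not-affine 2<n affine = ⊖𝟙≢𝟙 2<n (begin
    ⊖ 𝟙                   ≡⟨ identityˡ (⊖ 𝟙) ⟨
    proj₁ (swap (s · r))  ≡⟨ affine-image-comm ⊕-comm proj₁ proj₁-· affine s r ⟩
    proj₁ (swap (r · s))  ≡⟨ ⊕-identityʳ 𝟙 ⟩
    𝟙                     ∎)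
    where
    open ≡-Reasoning
    r : Carrier
    r = (𝟘 , 𝟙 , false)

  infix 4 _⇝_
  _⇝_ : Fin n × Fin n → Fin n × Fin n → Set
  (a , i) ⇝ (a′ , i′) = Path Gens (a , i , false) (a′ , i′ , false)

  Translation : ℕ → ℕ → Set
  Translation k m = ∀ a i → (a , i) ⇝ (a ⊕ residue k , i ⊕ residue m)

  translation-* : ∀ {k m} → Translation k m → ∀ j → Translation (j * k) (j * m)
  translation-* _ zero a i =
    subst₂ (λ u v → (a , i) ⇝ (u , v)) (sym (⊕-identityʳ a)) (sym (⊕-identityʳ i)) here
  translation-* {k} {m} τ (suc j) a i =
    subst₂ (λ u v → (a , i) ⇝ (u , v)) (sym (⊕-residue-+ a k (j * k))) (sym (⊕-residue-+ i m (j * m)))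
      (τ a i ++ translation-* τ j (a ⊕ residue k) (i ⊕ residue m))

  path-s : ∀ a i b → Path Gens (a , i , b) (a , i , not b)
  path-s a i b = subst (Path Gens (a , i , b)) (·s a i b) (path-edge (inj₁ refl))

  translation-t : Translation 1 1
  translation-t a i = path-edge (inj₂ (inj₁ refl))

  translation-tst⁻¹s : Translation 0 2
  translation-tst⁻¹s a i =
    subst₂ (λ u v → (a , i) ⇝ (u , v)) a-end i-end
      (translation-t a i ++ path-s _ _ false ++ path-edge (inj₂ (inj₂ refl)) ++ path-s _ _ true)
    where
    a-end : (a ⊕ 𝟙) ⊕ (⊖ 𝟙) ≡ a ⊕ 𝟘
    a-end = trans (⊕-assoc a 𝟙 (⊖ 𝟙)) (cong (a ⊕_) (⊕-inverseʳ 𝟙))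
    i-end : (i ⊕ 𝟙) ⊕ (⊖ (⊖ 𝟙)) ≡ i ⊕ residue 2
    i-end = trans (cong ((i ⊕ 𝟙) ⊕_) (⁻¹-involutive 𝟙)) (sym (⊕-residue-+ i 1 1))

  rotations-connected : ¬ 2 ∣ n → ∀ a i a′ i′ → (a , i) ⇝ (a′ , i′)
  rotations-connected n-odd a i a′ i′ =
    let j , a⊕j≡a′ = residue-translate a a′
        k , i⊕j⊕2k≡i′ = residue-double-translate n-odd (i ⊕ residue j) i′
    in subst₂ (λ u v → (a , i) ⇝ (u , v))
         (trans (cong₂ (λ u v → (a ⊕ residue u) ⊕ residue v) (*-identityʳ j) (*-zeroʳ k))
                (trans (⊕-identityʳ _) a⊕j≡a′))
         (trans (cong (λ u → (i ⊕ residue u) ⊕ residue (k * 2)) (*-identityʳ j)) i⊕j⊕2k≡i′)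
         (translation-* translation-t j a i ++ translation-* translation-tst⁻¹s k _ _)

  to-rotation : ∀ a i b → Path Gens (a , i , b) (a , i , false)
  to-rotation a i false = here
  to-rotation a i true  = path-s a i true

  from-rotation : ∀ a i b → Path Gens (a , i , false) (a , i , b)
  from-rotation a i false = here
  from-rotation a i true  = path-s a i false

  Gens-connected : ¬ 2 ∣ n → Connected Gens
  Gens-connected n-odd (a , i , b) (a′ , i′ , b′) =
    to-rotation a i b ++ rotations-connected n-odd a i a′ i′ ++ from-rotation a′ i′ b′

corollary3p2 : (n : ℕ) .{{_ : NonZero n}} → 3 ≤ n → ¬ (2 ∣ n) → Cayley.NonCCA (CnD2n n)
corollary3p2 n 2<n n-odd =
  Gens , Gens-nonidentity (<-trans (n<1+n 1) 2<n) , Gens-connected n-odd ,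
  swap , swap-colourPreservingAut , swap-not-affine 2<n
  where open SwapAutomorphism n
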